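{- Fix a nested system of fundamental sequences on an ordinal $\Gamma$. If $\beta<\delta\le\Gamma$, then $\beta\le\delta[|\beta|]$.
   Context: A fundamental sequence for $\alpha>0$ is a non-decreasing sequence $(\alpha[n])_{n\in\omega}$ with $\sup_n(\alpha[n]+1)=\alpha$; $0[n]=0$. A system on $\Gamma$ fixes one for each $\alpha\le\Gamma$; it is nested if there are never $\gamma<\beta\le\Gamma$ and $n>1$ with $\gamma>\beta[n]>\gamma[n]$. $\alpha\Rightarrow_n\beta$ means $\beta=\alpha[n]\cdots[n]$ for some finite number (possibly $0$) of applications of $[n]$. The norm $|\alpha|$ of $\alpha\le\Gamma$ is $\min\{n>1:\Gamma\Rightarrow_n\alpha\}$ (this exists for nested systems). -}

module Defs where

open import Data.Nat using (ℕ; _≤_) renaming (_<_ to _<ℕ_)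
open import Data.Product using (∃; _×_; Σ)
open import Data.Sum using (_⊎_)
open import Relation.Nullary using (¬_)
open import Data.Empty using (⊥)
open import Relation.Binary.PropositionalEquality using (_≡_)
open import Relation.Binary.Structures using (IsStrictTotalOrder)
open import Induction.WellFounded using (WellFounded)

-- The ordinals α ≤ Γ, i.e. the ordinal Γ+1 = [0, Γ], presented as a
-- well-ordered set (strict total order that is well-founded) with a least
-- element 𝟎 and a greatest element Γ.  Every ordinal Γ gives such a
-- structure, and every such structure is order-isomorphic to some Γ+1.
record OrdUpTo : Set₁ where
  infix 4 _<_ _≤o_
  field
    Carrier : Set
    _<_     : Carrier → Carrier → Set
    isSTO   : IsStrictTotalOrder _≡_ _<_
    wf      : WellFounded _<_
    𝟎       : Carrier
    Γ       : Carrier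

  _≤o_ : Carrier → Carrier → Set
  α ≤o β = α < β ⊎ α ≡ β

  field
    𝟎-least : ∀ α → 𝟎 ≤o α
    Γ-great : ∀ α → α ≤o Γ

module _ (O : OrdUpTo) where
  open OrdUpTo O

  -- A system of fundamental sequences: α [ n ] = fs α n.
  -- For α > 0: non-decreasing, and sup_n (α[n]+1) = α, i.e.
  -- every α[n] < α and every γ < α satisfies γ ≤ α[n] for some n.
  record IsSystem (fs : Carrier → ℕ → Carrier) : Set where
    field
      zero-seq  : ∀ n → fs 𝟎 n ≡ 𝟎
      monotone  : ∀ α → ¬ (α ≡ 𝟎) → ∀ {n m} → n ≤ m → fs α n ≤o fs α m
      below     : ∀ α → ¬ (α ≡ 𝟎) → ∀ n → fs α n < α
      cofinal   : ∀ α → ¬ (α ≡ 𝟎) → ∀ γ → γ < α → ∃ λ n → γ ≤o fs α n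

  Nested : (Carrier → ℕ → Carrier) → Set
  Nested fs = ∀ γ β n → γ < β → 1 <ℕ n → fs β n < γ → fs γ n < fs β n → ⊥

  -- α ⇒ₙ β : β = α[n]⋯[n] (finitely many, possibly 0, applications).
  data Reaches (fs : Carrier → ℕ → Carrier) (n : ℕ) : Carrier → Carrier → Set where
    done : ∀ {α} → Reaches fs n α α
    step : ∀ {α β} → Reaches fs n (fs α n) β → Reaches fs n α β

  -- n is the norm |β| : the least n > 1 with Γ ⇒ₙ β.
  IsNorm : (Carrier → ℕ → Carrier) → ℕ → Carrier → Set
  IsNorm fs n β = 1 <ℕ n × Reaches fs n Γ β
                  × (∀ m → 1 <ℕ m → m <ℕ n → ¬ Reaches fs m Γ β)

{-# OPTIONS --safe #-}
-- Follow the descent Γ, Γ[n], Γ[n][n], … down to β and let α be its last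
-- term with δ ≤ α.  If δ = α, then δ[n] is itself a later term of the
-- descent, hence ≥ β.  Otherwise α[n] < δ < α, and nestedness rules out
-- δ[n] < α[n], so δ[n] ≥ α[n] ≥ β.
module Submission where

open import Defs
open import Data.Nat using (ℕ) renaming (_<_ to _<ℕ_)
open import Data.Product using (_,_)
open import Data.Sum using (inj₁; inj₂)
open import Data.Empty using (⊥-elim)
open import Relation.Nullary using (¬_; yes; no)
open import Relation.Binary.PropositionalEquality using (refl)
open import Relation.Binary.Definitions using (tri<; tri≈; tri>)
open import Relation.Binary.Structures using (IsStrictTotalOrder; IsTotalOrder)
open import Relation.Binary.Construct.StrictToNonStrict using (isTotalOrder)

module SystemOfFundamentalSequences
  (O : OrdUpTo) (fs : OrdUpTo.Carrier O → ℕ → OrdUpTo.Carrier O) (system : IsSystem O fs)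
  where

  open OrdUpTo O
  open IsSystem system
  open IsStrictTotalOrder isSTO using (compare; irrefl; _≟_; _<?_) renaming (trans to <-trans)
  open IsTotalOrder (isTotalOrder _ _ isSTO) using () renaming (trans to ≤-trans)

  ≮⇒≥ : ∀ {α β} → ¬ α < β → β ≤o α
  ≮⇒≥ {α} {β} α≮β with compare α β
  ... | tri< α<β _ _ = ⊥-elim (α≮β α<β)
  ... | tri≈ _ refl _ = inj₂ refl
  ... | tri> _ _ β<α = inj₁ β<α

  <⇒≱ : ∀ {α β} → α < β → ¬ β ≤o α
  <⇒≱ α<β (inj₁ β<α) = irrefl refl (<-trans α<β β<α)
  <⇒≱ α<α (inj₂ refl) = irrefl refl α<α

  fs-≤ : ∀ α n → fs α n ≤o α
  fs-≤ α n with α ≟ 𝟎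
  ... | yes refl = inj₂ (zero-seq n)
  ... | no α≢𝟎 = inj₁ (below α α≢𝟎 n)

  Reaches⇒≤ : ∀ {n α β} → Reaches O fs n α β → β ≤o α
  Reaches⇒≤ done = inj₂ refl
  Reaches⇒≤ {n} {α} (step α[n]⇒β) = ≤-trans (Reaches⇒≤ α[n]⇒β) (fs-≤ α n)

  module _ (nested : Nested O fs) {n : ℕ} (1<n : 1 <ℕ n) where

    nested-fs-≥ : ∀ {α δ} → δ < α → fs α n < δ → fs α n ≤o fs δ n
    nested-fs-≥ {α} δ<α α[n]<δ = ≮⇒≥ (nested _ α n δ<α 1<n α[n]<δ)

    Reaches⇒≤-fs : ∀ {α β δ} → Reaches O fs n α β → β < δ → δ ≤o α → β ≤o fs δ n
    Reaches⇒≤-fs done β<δ δ≤β = ⊥-elim (<⇒≱ β<δ δ≤β)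
    Reaches⇒≤-fs (step α[n]⇒β) β<δ (inj₂ refl) = Reaches⇒≤ α[n]⇒β
    Reaches⇒≤-fs {α} {δ = δ} (step α[n]⇒β) β<δ (inj₁ δ<α) with fs α n <? δ
    ... | yes α[n]<δ = ≤-trans (Reaches⇒≤ α[n]⇒β) (nested-fs-≥ δ<α α[n]<δ)
    ... | no α[n]≮δ = Reaches⇒≤-fs α[n]⇒β β<δ (≮⇒≥ α[n]≮δ)

proposition2p12 : (O : OrdUpTo) → let open OrdUpTo O in
    (fs : Carrier → ℕ → Carrier) → IsSystem O fs → Nested O fs →
    ∀ β δ → β < δ → ∀ n → IsNorm O fs n β → β ≤o fs δ n
proposition2p12 O fs system nested β δ β<δ n (1<n , Γ⇒β , _) =
  SystemOfFundamentalSequences.Reaches⇒≤-fs O fs system nested 1<n Γ⇒β β<δ (OrdUpTo.Γ-great O δ)
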